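{- $$\#\left\{n<N:\ s_2(n^2)=s_2(n)\right\}\gg N^{1/19}.$$
   Context: $s_2(m)$ denotes the sum of the binary digits of the nonnegative integer $m$ (i.e. the number of ones in its binary expansion). $n$ ranges over positive integers. -}

module Defs where

open import Data.Nat using (ℕ; zero; suc; _+_; _*_; _≟_)
open import Data.Nat.DivMod using (_%_; _/_)
open import Data.List using (List; []; length; filter; upTo; map)

-- binary digit sum with fuel; fuel m suffices since m / 2 < m for m > 0
s₂-go : ℕ → ℕ → ℕ
s₂-go zero    m = 0
s₂-go (suc f) m = m % 2 + s₂-go f (m / 2)

s₂ : ℕ → ℕ
s₂ m = s₂-go m m

positivesBelow : ℕ → List ℕ
positivesBelow zero    = []
positivesBelow (suc N) = map suc (upTo N)

count : ℕ → ℕ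
count N = length (filter (λ n → s₂ (n * n) ≟ s₂ n) (positivesBelow N))

module Submission where

-- Binary digit sums add up over non-overlapping blocks (s₂-concat), and complementary
-- numbers v + w = 2^k − 1 satisfy s₂ v + s₂ w = k (s₂-complement).  For q = 2^j − 1 and a small
-- x with s₂ x + s₂ (x²) = j + 1, both n = 2^M q − x and n² = 2^M (2^M (q² − 1) + 2^M − 2qx) + x²
-- split into such blocks, and their digit sums come out equal (the reflection lemma).
-- The explicit family x = 2^(2c+1) (2^c − 1) + y, 1 ≤ y < 2^c, meets these hypotheses with
-- M = 10c and yields 2^(c−1) distinct solutions below 2^(16c) (Family, count-lower).
-- Bracketing N between consecutive powers of 2^16 then gives N ≤ 2^32 · count(N)^19.

open import Defs
open import Data.Nat
open import Data.Nat.Properties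
open import Data.Nat.DivMod
open import Data.Nat.Divisibility using (m∣m*n)
open import Data.Nat.Induction using (<-rec)
open import Data.Nat.Tactic.RingSolver using (solve-∀)
open import Data.Product using (∃-syntax; _×_; _,_)
open import Data.Sum using (inj₁; inj₂)
open import Data.Empty using (⊥-elim)
open import Data.Fin using (Fin; toℕ)
open import Data.Fin.Properties using (toℕ<n; toℕ-injective; injective⇒≤)
open import Data.List using (lookup; filter)
open import Data.List.Relation.Unary.Any using (index)
open import Data.List.Relation.Unary.Any.Properties using (lookup-index)
open import Data.List.Membership.Propositional using (_∈_)
open import Data.List.Membership.Propositional.Properties using (∈-filter⁺; ∈-map⁺; ∈-upTo⁺)
open import Function.Definitions using (Injective)
open import Relation.Nullary using (Dec)
open import Relation.Binary.PropositionalEquality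

s₂-go-zero : ∀ f → s₂-go f 0 ≡ 0
s₂-go-zero zero    = refl
s₂-go-zero (suc f) = s₂-go-zero f

s₂-go-fuel : ∀ f g m → m ≤ f → m ≤ g → s₂-go f m ≡ s₂-go g m
s₂-go-fuel zero    zero    m       _ _ = refl
s₂-go-fuel zero    (suc g) .0      z≤n _ = sym (s₂-go-zero (suc g))
s₂-go-fuel (suc f) zero    .0      _ z≤n = s₂-go-zero (suc f)
s₂-go-fuel (suc f) (suc g) zero    _ _ = s₂-go-fuel f g 0 z≤n z≤n
s₂-go-fuel (suc f) (suc g) (suc m) m<f m<g =
  cong (suc m % 2 +_) (s₂-go-fuel f g (suc m / 2) (half≤ m<f) (half≤ m<g))
  where
  half≤ : ∀ {k} → suc m ≤ suc k → suc m / 2 ≤ k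
  half≤ (s≤s m≤k) = ≤-pred (≤-trans (m/n<m (suc m) 2 (s≤s (s≤s z≤n))) (s≤s m≤k))

s₂-unfold : ∀ m → s₂ m ≡ m % 2 + s₂ (m / 2)
s₂-unfold m = trans (s₂-go-fuel m (suc m) m ≤-refl (n≤1+n m))
  (cong (m % 2 +_) (s₂-go-fuel m (m / 2) (m / 2) (m/n≤m m 2) ≤-refl))

s₂-bit : ∀ {b} m → b ≤ 1 → s₂ (b + 2 * m) ≡ b + s₂ m
s₂-bit {b} m b≤1 = trans (s₂-unfold (b + 2 * m)) (cong₂ _+_ last rest)
  where
  last : (b + 2 * m) % 2 ≡ b
  last = trans (%-remove-+ʳ b (m∣m*n m)) (m<n⇒m%n≡m (s≤s b≤1))
  rest : s₂ ((b + 2 * m) / 2) ≡ s₂ m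
  rest = cong s₂ (trans (+-distrib-/-∣ʳ b (m∣m*n m))
           (cong₂ _+_ (m<n⇒m/n≡0 (s≤s b≤1)) (trans (cong (_/ 2) (*-comm 2 m)) (m*n/n≡m m 2))))

bit-split : ∀ v → ∃[ b ] ∃[ m ] b ≤ 1 × v ≡ b + 2 * m
bit-split v = v % 2 , v / 2 , ≤-pred (m%n<n v 2)
            , trans (m≡m%n+[m/n]*n v 2) (cong (v % 2 +_) (*-comm (v / 2) 2))

s₂-double : ∀ m → s₂ (2 * m) ≡ s₂ m
s₂-double m = s₂-bit m z≤n

s₂-concat : ∀ k u {v} → v < 2 ^ k → s₂ (2 ^ k * u + v) ≡ s₂ u + s₂ v
s₂-concat zero u {zero} _ = trans (cong s₂ (+-identityʳ (1 * u)))
  (trans (cong s₂ (*-identityˡ u)) (sym (+-identityʳ (s₂ u))))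
s₂-concat zero u {suc v} (s≤s ())
s₂-concat (suc k) u {v} v<2P with bit-split v
... | b , m , b≤1 , refl = begin
    s₂ (2 * P * u + (b + 2 * m))  ≡⟨ cong s₂ (shift-digit P u b m) ⟩
    s₂ (b + 2 * (P * u + m))      ≡⟨ s₂-bit (P * u + m) b≤1 ⟩
    b + s₂ (P * u + m)            ≡⟨ cong (b +_) (s₂-concat k u m<P) ⟩
    b + (s₂ u + s₂ m)             ≡⟨ +-comm b (s₂ u + s₂ m) ⟩
    s₂ u + s₂ m + b               ≡⟨ +-assoc (s₂ u) (s₂ m) b ⟩
    s₂ u + (s₂ m + b)             ≡⟨ cong (s₂ u +_) (+-comm (s₂ m) b) ⟩
    s₂ u + (b + s₂ m)             ≡⟨ cong (s₂ u +_) (sym (s₂-bit m b≤1)) ⟩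
    s₂ u + s₂ (b + 2 * m)         ∎
  where
  open ≡-Reasoning
  P = 2 ^ k
  shift-digit : ∀ P u b m → 2 * P * u + (b + 2 * m) ≡ b + 2 * (P * u + m)
  shift-digit = solve-∀
  m<P : m < P
  m<P = *-cancelˡ-< 2 m P (≤-trans (s≤s (m≤n+m (2 * m) b)) v<2P)

s₂-shift : ∀ k u → s₂ (2 ^ k * u) ≡ s₂ u
s₂-shift k u = trans (cong s₂ (sym (+-identityʳ (2 ^ k * u))))
  (trans (s₂-concat k u (m^n>0 2 k)) (+-identityʳ (s₂ u)))

private
  both-even : ∀ v w → 0 + 2 * v + (0 + 2 * w) + 1 ≡ suc (2 * (v + w))
  both-even = solve-∀
  both-odd : ∀ v w → 1 + 2 * v + (1 + 2 * w) + 1 ≡ suc (2 * (v + w + 1))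
  both-odd = solve-∀
  even-odd : ∀ v w → 2 * (v + w + 1) ≡ 0 + 2 * v + (1 + 2 * w) + 1
  even-odd = solve-∀
  odd-even : ∀ v w → 2 * (v + w + 1) ≡ 1 + 2 * v + (0 + 2 * w) + 1
  odd-even = solve-∀
  halve : ∀ k {n a} → 2 * n ≡ a → a ≡ 2 * 2 ^ k → n ≡ 2 ^ k
  halve k {n} refl e = *-cancelˡ-≡ n (2 ^ k) 2 e

-- Complementary numbers: if v + w = 2^k - 1 then every one of the k digit positions
-- carries a one in exactly one of v and w.
s₂-complement : ∀ k v w → v + w + 1 ≡ 2 ^ k → s₂ v + s₂ w ≡ k
s₂-complement zero v w v+w+1≡1 with m+n≡0⇒m≡0 v v+w≡0 | m+n≡0⇒n≡0 v v+w≡0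
  where
  v+w≡0 : v + w ≡ 0
  v+w≡0 = +-cancelʳ-≡ 1 (v + w) 0 v+w+1≡1
... | refl | refl = refl
s₂-complement (suc k) v w eq with bit-split v | bit-split w
... | b , v′ , b≤1 , refl | b′ , w′ , b′≤1 , refl with b≤1 | b′≤1
... | z≤n     | z≤n     = ⊥-elim (even≢odd (2 ^ k) (v′ + w′) (trans (sym eq) (both-even v′ w′)))
... | s≤s z≤n | s≤s z≤n = ⊥-elim (even≢odd (2 ^ k) (v′ + w′ + 1) (trans (sym eq) (both-odd v′ w′)))
... | z≤n     | s≤s z≤n =
  trans (cong₂ _+_ (s₂-double v′) (s₂-bit w′ (s≤s z≤n)))
        (trans (+-suc (s₂ v′) (s₂ w′)) (cong suc (s₂-complement k v′ w′ (halve k (even-odd v′ w′) eq))))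
... | s≤s z≤n | z≤n     =
  trans (cong₂ _+_ (s₂-bit v′ (s≤s z≤n)) (s₂-double w′))
        (cong suc (s₂-complement k v′ w′ (halve k (odd-even v′ w′) eq)))

s₂-≤ : ∀ k {m} → m < 2 ^ k → s₂ m ≤ k
s₂-≤ zero    {zero}  _ = z≤n
s₂-≤ zero    {suc m} (s≤s ())
s₂-≤ (suc k) {m} m<2P with bit-split m
... | b , m′ , b≤1 , refl = subst (_≤ suc k) (sym (s₂-bit m′ b≤1))
  (+-mono-≤ b≤1 (s₂-≤ k (*-cancelˡ-< 2 m′ (2 ^ k) (≤-trans (s≤s (m≤n+m (2 * m′) b)) m<2P))))

s₂-pos : ∀ m → 1 ≤ m → 1 ≤ s₂ m
s₂-pos = <-rec (λ m → 1 ≤ m → 1 ≤ s₂ m) step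
  where
  step : ∀ m → (∀ {k} → k < m → 1 ≤ k → 1 ≤ s₂ k) → 1 ≤ m → 1 ≤ s₂ m
  step m smaller 1≤m with bit-split m
  ... | _ , m′ , s≤s z≤n , refl = subst (1 ≤_) (sym (s₂-bit m′ (s≤s z≤n))) (s≤s z≤n)
  ... | _ , zero , z≤n , refl = 1≤m
  ... | _ , suc m′ , z≤n , refl =
    subst (1 ≤_) (sym (s₂-double (suc m′))) (smaller (m<m+n (suc m′) (s≤s z≤n)) (s≤s z≤n))

-- Multiples of a repunit: if C = 2^c - 1 and 1 ≤ y ≤ C then C·y = 2^c (y - 1) + (C - y + 1),
-- two complementary blocks, so its digit sum is exactly c.
s₂-repunit-multiple : ∀ {c C y} → C + 1 ≡ 2 ^ c → 1 ≤ y → y ≤ C → s₂ (C * y) ≡ c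
s₂-repunit-multiple {c} {C} {suc y} C+1≡2^c (s≤s z≤n) y<C with m≤n⇒∃[o]m+o≡n (<⇒≤ y<C)
... | e , refl = begin
    s₂ ((y + e) * suc y)          ≡⟨ cong s₂ (split-blocks y e) ⟩
    s₂ ((y + e + 1) * y + e)      ≡⟨ cong (λ P → s₂ (P * y + e)) C+1≡2^c ⟩
    s₂ (2 ^ c * y + e)            ≡⟨ s₂-concat c y e<2^c ⟩
    s₂ y + s₂ e                   ≡⟨ s₂-complement c y e C+1≡2^c ⟩
    c                             ∎
  where
  open ≡-Reasoning
  split-blocks : ∀ y e → (y + e) * suc y ≡ (y + e + 1) * y + e
  split-blocks = solve-∀
  e<2^c : e < 2 ^ c
  e<2^c = subst (e <_) C+1≡2^c (≤-trans (s≤s (m≤n+m e y)) (≤-reflexive (+-comm 1 (y + e))))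

<-of-+1≡ : ∀ {a b c} → a + b + 1 ≡ c → a < c
<-of-+1≡ {a} {b} refl = ≤-<-trans (m≤m+n a b) (m<m+n (a + b) (s≤s z≤n))

reflect : ℕ → ℕ → ℕ → ℕ
reflect M q x = 2 ^ M * q ∸ x

sub-split : ∀ {P t x} Q → t + x ≡ P → P * suc Q ∸ x ≡ P * Q + t
sub-split {P} {t} {x} Q t+x≡P = begin
  P * suc Q ∸ x          ≡⟨ cong (_∸ x) (*-suc P Q) ⟩
  P + P * Q ∸ x          ≡⟨ cong (λ R → R + P * Q ∸ x) (sym t+x≡P) ⟩
  t + x + P * Q ∸ x      ≡⟨ cong (_∸ x) (rearrange t x (P * Q)) ⟩
  P * Q + t + x ∸ x      ≡⟨ m+n∸n≡m (P * Q + t) x ⟩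
  P * Q + t              ∎
  where
  open ≡-Reasoning
  rearrange : ∀ t x R → t + x + R ≡ R + t + x
  rearrange = solve-∀

sub-mod : ∀ {P} .{{_ : NonZero P}} {t x} Q → t + x ≡ P → 1 ≤ x → (P * suc Q ∸ x) % P ≡ t
sub-mod {P} {t} {x} Q t+x≡P 1≤x = begin
  (P * suc Q ∸ x) % P  ≡⟨ cong (_% P) (sub-split Q t+x≡P) ⟩
  (P * Q + t) % P      ≡⟨ %-remove-+ˡ t (m∣m*n Q) ⟩
  t % P                ≡⟨ m<n⇒m%n≡m (subst (t <_) t+x≡P (m<m+n t 1≤x)) ⟩
  t                    ∎
  where open ≡-Reasoning

-- Distinct x ≤ 2^M give distinct candidates, whatever the (positive) multipliers q:
-- the lowest M binary digits of 2^M q − x are those of 2^M − x.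
reflect-injective : ∀ M {q q′ x x′} → 1 ≤ q → 1 ≤ q′ → 1 ≤ x → 1 ≤ x′ → x ≤ 2 ^ M → x′ ≤ 2 ^ M →
                    reflect M q x ≡ reflect M q′ x′ → x ≡ x′
reflect-injective M {suc Q} {suc Q′} {x} {x′} _ _ 1≤x 1≤x′ x≤P x′≤P same
  with m≤n⇒∃[o]m+o≡n x≤P | m≤n⇒∃[o]m+o≡n x′≤P
... | t , x+t≡P | t′ , x′+t′≡P =
  +-cancelʳ-≡ t x x′ (trans x+t≡P (sym (trans (cong (x′ +_) t≡t′) x′+t′≡P)))
  where
  instance
    2^M≢0 : NonZero (2 ^ M)
    2^M≢0 = m^n≢0 2 M
  t≡t′ : t ≡ t′
  t≡t′ = trans (sym (sub-mod Q (trans (+-comm t x) x+t≡P) 1≤x))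
           (trans (cong (_% 2 ^ M) same) (sub-mod Q′ (trans (+-comm t′ x′) x′+t′≡P) 1≤x′))

-- Linear bookkeeping behind the reflection lemma: with σ, τ, ξ, ξ′, ε, ρ the digit sums of
-- s, t, x, x − 1, e, x², the complement relations force s₂ s + s₂ (x²) = s₂ t.
digit-balance : ∀ {σ τ ξ ξ′ ε ρ j M} → τ + ξ′ ≡ M → σ + suc (ξ′ + ε) ≡ M → ε + ξ ≡ j →
                ξ + ρ ≡ suc j → σ + ρ ≡ τ
digit-balance {σ} {τ} {ξ} {ξ′} {ε} {ρ} refl σ-eq refl ρ-eq =
  +-cancelʳ-≡ ξ′ (σ + ρ) τ (trans (cong (λ r → σ + r + ξ′) ρ≡1+ε) (trans (regroup σ ε ξ′) σ-eq))
  where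
  ρ≡1+ε : ρ ≡ suc ε
  ρ≡1+ε = +-cancelˡ-≡ ξ ρ (suc ε) (trans ρ-eq (trans (cong suc (+-comm ε ξ)) (sym (+-suc ξ ε))))
  regroup : ∀ σ ε ξ′ → σ + suc ε + ξ′ ≡ σ + suc (ξ′ + ε)
  regroup = solve-∀

-- The reflection computation, in coordinates: Q = x′ + e, q = Q + 1, x = x′ + 1 (so x ≤ q and
-- e = q − x), P = 2^M = 2qx + s and q + 1 = 2^j.  Then n = 2^M q − x = P Q + t with t = P − x, and
-- n² = P (P A + s) + x² with A = q² − 1 = 2^j Q: both are concatenations of binary blocks.
module Reflection (j M x′ e s : ℕ) (q+1≡2^j : suc (x′ + e) + 1 ≡ 2 ^ j)
                  (2qx+s≡P : 2 * suc (x′ + e) * suc x′ + s ≡ 2 ^ M) (x²<P : suc x′ * suc x′ < 2 ^ M)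
                  (digits : s₂ (suc x′) + s₂ (suc x′ * suc x′) ≡ suc j) where
  P = 2 ^ M
  Q = x′ + e
  x = suc x′
  n = reflect M (suc Q) x
  t = s + (2 * Q + 1) * x
  A = Q * (Q + 2)
  w = (Q + 2) * x′ + e

  Q+2≡2^j : Q + 2 ≡ 2 ^ j
  Q+2≡2^j = trans (+-suc Q 1) q+1≡2^j

  t+x≡P : t + x ≡ P
  t+x≡P = trans (t-id Q x s) 2qx+s≡P
    where
    t-id : ∀ Q x s → s + (2 * Q + 1) * x + x ≡ 2 * suc Q * x + s
    t-id = solve-∀

  n≡PQ+t : n ≡ P * Q + t
  n≡PQ+t = sub-split Q t+x≡P

  s₂n : s₂ n ≡ s₂ Q + s₂ t
  s₂n = trans (cong s₂ n≡PQ+t) (s₂-concat M Q (subst (t <_) t+x≡P (m<m+n t (s≤s z≤n))))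

  square : n * n ≡ P * (P * A + s) + x * x
  square = begin
    n * n                          ≡⟨ cong (λ m → m * m) n≡PQ+t ⟩
    (P * Q + t) * (P * Q + t)      ≡⟨ cong (λ R → (R * Q + t) * (R * Q + t)) (sym 2qx+s≡P) ⟩
    _                              ≡⟨ square-id Q x s ⟩
    _                              ≡⟨ cong (λ R → R * (R * A + s) + x * x) 2qx+s≡P ⟩
    P * (P * A + s) + x * x        ∎
    where
    open ≡-Reasoning
    square-id : ∀ Q x s → let R = 2 * suc Q * x + s in
      (R * Q + (s + (2 * Q + 1) * x)) * (R * Q + (s + (2 * Q + 1) * x)) ≡ R * (R * (Q * (Q + 2)) + s) + x * x
    square-id = solve-∀

  s₂n² : s₂ (n * n) ≡ s₂ Q + s₂ s + s₂ (x * x)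
  s₂n² = begin
    s₂ (n * n)                      ≡⟨ cong s₂ square ⟩
    s₂ (P * (P * A + s) + x * x)    ≡⟨ s₂-concat M (P * A + s) x²<P ⟩
    s₂ (P * A + s) + s₂ (x * x)     ≡⟨ cong (_+ s₂ (x * x)) (s₂-concat M A s<P) ⟩
    s₂ A + s₂ s + s₂ (x * x)        ≡⟨ cong (λ a → a + s₂ s + s₂ (x * x)) s₂A≡s₂Q ⟩
    s₂ Q + s₂ s + s₂ (x * x)        ∎
    where
    open ≡-Reasoning
    s<P : s < P
    s<P = subst (s <_) 2qx+s≡P (m<n+m s (s≤s z≤n))
    s₂A≡s₂Q : s₂ A ≡ s₂ Q
    s₂A≡s₂Q = trans (cong s₂ (trans (cong (Q *_) Q+2≡2^j) (*-comm Q (2 ^ j)))) (s₂-shift j Q)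

  t-complement : s₂ t + s₂ x′ ≡ M
  t-complement = s₂-complement M t x′ (trans (+-assoc t x′ 1) (trans (cong (t +_) (+-comm x′ 1)) t+x≡P))

  e+x+1≡2^j : e + x + 1 ≡ 2 ^ j
  e+x+1≡2^j = trans (e-id x′ e) q+1≡2^j
    where
    e-id : ∀ x′ e → e + suc x′ + 1 ≡ suc (x′ + e) + 1
    e-id = solve-∀

  -- 2qx − 1 = 1 + 2w with w = 2^j (x − 1) + e
  s-complement : s₂ s + suc (s₂ x′ + s₂ e) ≡ M
  s-complement = trans (cong (λ r → s₂ s + suc r) (sym s₂w))
    (trans (cong (s₂ s +_) (sym (s₂-bit w (s≤s z≤n))))
           (s₂-complement M s (1 + 2 * w) (trans (s-id x′ e s) 2qx+s≡P)))
    where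
    s-id : ∀ x′ e s → s + (1 + 2 * ((x′ + e + 2) * x′ + e)) + 1 ≡ 2 * suc (x′ + e) * suc x′ + s
    s-id = solve-∀
    s₂w : s₂ w ≡ s₂ x′ + s₂ e
    s₂w = trans (cong (λ K → s₂ (K * x′ + e)) Q+2≡2^j) (s₂-concat j x′ (<-of-+1≡ e+x+1≡2^j))

  solution : s₂ (n * n) ≡ s₂ n
  solution = begin
    s₂ (n * n)                      ≡⟨ s₂n² ⟩
    s₂ Q + s₂ s + s₂ (x * x)        ≡⟨ +-assoc (s₂ Q) (s₂ s) (s₂ (x * x)) ⟩
    s₂ Q + (s₂ s + s₂ (x * x))      ≡⟨ cong (s₂ Q +_) balance ⟩
    s₂ Q + s₂ t                     ≡⟨ sym s₂n ⟩
    s₂ n                            ∎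
    where
    open ≡-Reasoning
    balance : s₂ s + s₂ (x * x) ≡ s₂ t
    balance = digit-balance t-complement s-complement (s₂-complement j e x e+x+1≡2^j) digits

reflection : ∀ {j M q x} → q + 1 ≡ 2 ^ j → 1 ≤ x → x ≤ q → 2 * q * x ≤ 2 ^ M → x * x < 2 ^ M →
             s₂ x + s₂ (x * x) ≡ suc j → s₂ (reflect M q x * reflect M q x) ≡ s₂ (reflect M q x)
reflection {j} {M} {suc _} {suc x′} q+1≡2^j (s≤s z≤n) (s≤s x′≤Q) 2qx≤P x²<P digits
  with m≤n⇒∃[o]m+o≡n x′≤Q | m≤n⇒∃[o]m+o≡n 2qx≤P
... | e , refl | s , 2qx+s≡P = Reflection.solution j M x′ e s q+1≡2^j 2qx+s≡P x²<P digits

*-<-2^ : ∀ {a b} i j → a < 2 ^ i → b < 2 ^ j → a * b < 2 ^ (i + j)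
*-<-2^ {a} {b} i j a<2^i b<2^j = subst (a * b <_) (sym (^-distribˡ-+-* 2 i j)) (*-mono-< a<2^i b<2^j)

module ExponentBounds {c σ : ℕ} (1≤c : 1 ≤ c) (σ≥ : 3 * c + 2 ≤ σ) (σ≤ : σ ≤ 6 * c) where
  open ≤-Reasoning

  x-digits : suc (suc (c + c) + c) ≤ σ
  x-digits = subst (_≤ σ) (lhs c) σ≥
    where
    lhs : ∀ c → 3 * c + 2 ≡ suc (suc (c + c) + c)
    lhs = solve-∀

  product-digits : σ + (suc (c + c) + c) ≤ 10 * c
  product-digits = begin
    σ + (suc (c + c) + c)      ≤⟨ +-monoˡ-≤ (suc (c + c) + c) σ≤ ⟩
    6 * c + (suc (c + c) + c)  ≡⟨ lhs c ⟩
    1 + 9 * c                  ≤⟨ +-monoˡ-≤ (9 * c) 1≤c ⟩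
    c + 9 * c                  ≡⟨ rhs c ⟩
    10 * c                     ∎
    where
    lhs : ∀ c → 6 * c + (suc (c + c) + c) ≡ 1 + 9 * c
    lhs = solve-∀
    rhs : ∀ c → c + 9 * c ≡ 10 * c
    rhs = solve-∀

  square-digits : (suc (c + c) + c) + (suc (c + c) + c) ≤ 10 * c
  square-digits = begin
    (suc (c + c) + c) + (suc (c + c) + c)  ≡⟨ lhs c ⟩
    2 * 1 + 6 * c                          ≤⟨ +-monoˡ-≤ (6 * c) (*-monoʳ-≤ 2 1≤c) ⟩
    2 * c + 6 * c                          ≤⟨ +-monoˡ-≤ (6 * c) (*-monoˡ-≤ c {2} {4} (s≤s (s≤s z≤n))) ⟩
    4 * c + 6 * c                          ≡⟨ rhs c ⟩
    10 * c                                 ∎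
    where
    lhs : ∀ c → (suc (c + c) + c) + (suc (c + c) + c) ≡ 2 * 1 + 6 * c
    lhs = solve-∀
    rhs : ∀ c → 4 * c + 6 * c ≡ 10 * c
    rhs = solve-∀

  candidate-digits : 10 * c + σ ≤ 16 * c
  candidate-digits = subst (10 * c + σ ≤_) (rhs c) (+-monoʳ-≤ (10 * c) σ≤)
    where
    rhs : ∀ c → 10 * c + 6 * c ≡ 16 * c
    rhs = solve-∀

-- The blocks of x and x² do not overlap, so s₂ x + s₂ (x²) = 3c + s₂ y + s₂ (y²) ∈ [3c + 2, 6c];
-- with j = s₂ x + s₂ (x²) − 1 and M = 10c the reflection lemma applies to n = 2^M (2^j − 1) − x.
module Family (c : ℕ) (1≤c : 1 ≤ c) (y : ℕ) (1≤y : 1 ≤ y) (y<2^c : y < 2 ^ c) where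
  C = 2 ^ c ∸ 1
  p = suc (c + c)
  x = 2 ^ p * C + y
  σ = s₂ x + s₂ (x * x)
  j = pred σ
  q = 2 ^ j ∸ 1
  M = 10 * c
  n = reflect M q x

  C+1≡2^c : C + 1 ≡ 2 ^ c
  C+1≡2^c = m∸n+n≡m (m^n>0 2 c)
  C<2^c : C < 2 ^ c
  C<2^c = subst (C <_) C+1≡2^c (m<m+n C (s≤s z≤n))
  1≤C : 1 ≤ C
  1≤C = +-cancelʳ-≤ 1 1 C (subst (2 ≤_) (sym C+1≡2^c) (^-monoʳ-≤ 2 1≤c))
  2^c≤2^p : 2 ^ c ≤ 2 ^ p
  2^c≤2^p = ^-monoʳ-≤ 2 (≤-trans (m≤m+n c c) (n≤1+n (c + c)))
  1≤x : 1 ≤ x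
  1≤x = ≤-trans 1≤y (m≤n+m y (2 ^ p * C))

  s₂x : s₂ x ≡ c + s₂ y
  s₂x = trans (s₂-concat p C (<-≤-trans y<2^c 2^c≤2^p)) (cong (_+ s₂ y) s₂C)
    where
    s₂C : s₂ C ≡ c
    s₂C = trans (cong s₂ (sym (*-identityʳ C))) (s₂-repunit-multiple C+1≡2^c ≤-refl 1≤C)

  s₂x² : s₂ (x * x) ≡ c + c + s₂ (y * y)
  s₂x² = begin
    s₂ (x * x)                                            ≡⟨ cong s₂ (square (2 ^ p) C y) ⟩
    s₂ (2 ^ p * (2 ^ p * (C * C) + 2 * (C * y)) + y * y)  ≡⟨ s₂-concat p _ y²<2^p ⟩
    s₂ (2 ^ p * (C * C) + 2 * (C * y)) + s₂ (y * y)       ≡⟨ cong (_+ s₂ (y * y)) (s₂-concat p (C * C) 2Cy<2^p) ⟩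
    s₂ (C * C) + s₂ (2 * (C * y)) + s₂ (y * y)            ≡⟨ cong (λ d → s₂ (C * C) + d + s₂ (y * y)) (s₂-double (C * y)) ⟩
    s₂ (C * C) + s₂ (C * y) + s₂ (y * y)                  ≡⟨ cong₂ (λ a b → a + b + s₂ (y * y)) s₂C² s₂Cy ⟩
    c + c + s₂ (y * y)                                    ∎
    where
    open ≡-Reasoning
    square : ∀ P C y → (P * C + y) * (P * C + y) ≡ P * (P * (C * C) + 2 * (C * y)) + y * y
    square = solve-∀
    y²<2^p : y * y < 2 ^ p
    y²<2^p = <-≤-trans (*-<-2^ c c y<2^c y<2^c) (^-monoʳ-≤ 2 (n≤1+n (c + c)))
    2Cy<2^p : 2 * (C * y) < 2 ^ p
    2Cy<2^p = *-monoʳ-< 2 (*-<-2^ c c C<2^c y<2^c)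
    s₂C² : s₂ (C * C) ≡ c
    s₂C² = s₂-repunit-multiple C+1≡2^c 1≤C ≤-refl
    s₂Cy : s₂ (C * y) ≡ c
    s₂Cy = s₂-repunit-multiple C+1≡2^c 1≤y (≤-pred (subst (y <_) (sym (trans (+-comm 1 C) C+1≡2^c)) y<2^c))

  -- 3c + 2 ≤ σ ≤ 6c, since 1 ≤ s₂ y ≤ c and 1 ≤ s₂ (y²) ≤ 2c
  σ≡3c+r : σ ≡ 3 * c + (s₂ y + s₂ (y * y))
  σ≡3c+r = trans (cong₂ _+_ s₂x s₂x²) (regroup c (s₂ y) (s₂ (y * y)))
    where
    regroup : ∀ c a b → c + a + (c + c + b) ≡ 3 * c + (a + b)
    regroup = solve-∀
  σ≥ : 3 * c + 2 ≤ σ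
  σ≥ = subst (3 * c + 2 ≤_) (sym σ≡3c+r)
    (+-monoʳ-≤ (3 * c) (+-mono-≤ (s₂-pos y 1≤y) (s₂-pos (y * y) (*-mono-≤ 1≤y 1≤y))))
  σ≤ : σ ≤ 6 * c
  σ≤ = subst (_≤ 6 * c) (sym σ≡3c+r) (subst (3 * c + (s₂ y + s₂ (y * y)) ≤_) (split c)
    (+-monoʳ-≤ (3 * c) (+-mono-≤ (s₂-≤ c y<2^c) (s₂-≤ (c + c) (*-<-2^ c c y<2^c y<2^c)))))
    where
    split : ∀ c → 3 * c + (c + (c + c)) ≡ 6 * c
    split = solve-∀
  open ExponentBounds 1≤c σ≥ σ≤

  1+j≡σ : suc j ≡ σ
  1+j≡σ = suc-pred σ {{>-nonZero (≤-trans (s≤s z≤n) (≤-trans (m≤n+m 2 (3 * c)) σ≥))}}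
  q+1≡2^j : q + 1 ≡ 2 ^ j
  q+1≡2^j = m∸n+n≡m (m^n>0 2 j)
  q<2^j : q < 2 ^ j
  q<2^j = subst (q <_) q+1≡2^j (m<m+n q (s≤s z≤n))

  x<2^[p+c] : x < 2 ^ (p + c)
  x<2^[p+c] = begin-strict
    2 ^ p * C + y        <⟨ +-monoʳ-< (2 ^ p * C) (<-≤-trans y<2^c 2^c≤2^p) ⟩
    2 ^ p * C + 2 ^ p    ≡⟨ sym (*-suc′ (2 ^ p) C) ⟩
    2 ^ p * (C + 1)      ≡⟨ cong (2 ^ p *_) C+1≡2^c ⟩
    2 ^ p * 2 ^ c        ≡⟨ sym (^-distribˡ-+-* 2 p c) ⟩
    2 ^ (p + c)          ∎
    where
    open ≤-Reasoning
    *-suc′ : ∀ P C → P * (C + 1) ≡ P * C + P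
    *-suc′ = solve-∀

  x≤q : x ≤ q
  x≤q = ≤-pred (subst (x <_) (trans (sym q+1≡2^j) (+-comm q 1))
          (<-≤-trans x<2^[p+c] (^-monoʳ-≤ 2 (≤-pred (subst (suc (p + c) ≤_) (sym 1+j≡σ) x-digits)))))
  2qx≤2^M : 2 * q * x ≤ 2 ^ M
  2qx≤2^M = <⇒≤ (<-≤-trans (*-<-2^ (suc j) (p + c) (*-monoʳ-< 2 q<2^j) x<2^[p+c])
              (^-monoʳ-≤ 2 (subst (λ s → s + (p + c) ≤ M) (sym 1+j≡σ) product-digits)))
  x²<2^M : x * x < 2 ^ M
  x²<2^M = <-≤-trans (*-<-2^ (p + c) (p + c) x<2^[p+c] x<2^[p+c]) (^-monoʳ-≤ 2 square-digits)

  solution : s₂ (n * n) ≡ s₂ n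
  solution = reflection {j} {M} q+1≡2^j 1≤x x≤q 2qx≤2^M x²<2^M (sym 1+j≡σ)

  1≤q : 1 ≤ q
  1≤q = ≤-trans 1≤x x≤q
  x<2^M : x < 2 ^ M
  x<2^M = ≤-<-trans (subst (_≤ x * x) (*-identityʳ x) (*-monoʳ-≤ x 1≤x)) x²<2^M

  1≤n : 1 ≤ n
  1≤n = m<n⇒0<n∸m (<-≤-trans x<2^M (subst (_≤ 2 ^ M * q) (*-identityʳ (2 ^ M)) (*-monoʳ-≤ (2 ^ M) 1≤q)))
  n<2^16c : n < 2 ^ (16 * c)
  n<2^16c = begin-strict
    2 ^ M * q ∸ x    ≤⟨ m∸n≤m (2 ^ M * q) x ⟩
    2 ^ M * q        <⟨ *-monoʳ-< (2 ^ M) q<2^j ⟩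
    2 ^ M * 2 ^ j    ≡⟨ sym (^-distribˡ-+-* 2 M j) ⟩
    2 ^ (M + j)      ≤⟨ ^-monoʳ-≤ 2 (≤-trans (+-monoʳ-≤ M (subst (j ≤_) 1+j≡σ (n≤1+n j))) candidate-digits) ⟩
    2 ^ (16 * c)     ∎
    where
    open ≤-Reasoning
    instance
      2^M≢0 : NonZero (2 ^ M)
      2^M≢0 = m^n≢0 2 M

-- Different y give different members: the low digits of n determine x, and x determines y.
family-injective : ∀ c (1≤c : 1 ≤ c) {y y′} (1≤y : 1 ≤ y) (y<2^c : y < 2 ^ c) (1≤y′ : 1 ≤ y′) (y′<2^c : y′ < 2 ^ c) →
                   Family.n c 1≤c y 1≤y y<2^c ≡ Family.n c 1≤c y′ 1≤y′ y′<2^c → y ≡ y′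
family-injective c 1≤c {y} {y′} 1≤y y<2^c 1≤y′ y′<2^c same =
  +-cancelˡ-≡ (2 ^ F.p * F.C) y y′
    (reflect-injective F.M F.1≤q F′.1≤q F.1≤x F′.1≤x (<⇒≤ F.x<2^M) (<⇒≤ F′.x<2^M) same)
  where
  module F  = Family c 1≤c y 1≤y y<2^c
  module F′ = Family c 1≤c y′ 1≤y′ y′<2^c

-- The solution predicate, decided exactly as in the definition of count.
solution? : (n : ℕ) → Dec (s₂ (n * n) ≡ s₂ n)
solution? n = s₂ (n * n) ≟ s₂ n

∈-positivesBelow : ∀ {n N} → 1 ≤ n → n < N → n ∈ positivesBelow N
∈-positivesBelow {suc n} {suc N} _ (s≤s n<N) = ∈-map⁺ suc (∈-upTo⁺ n<N)

-- Pigeonhole: C distinct solutions in [1, N) give count N ≥ C, via their positions in the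
-- list of all solutions below N.
count-≥ : ∀ {C} N (f : Fin C → ℕ) → Injective _≡_ _≡_ f → (∀ i → 1 ≤ f i) → (∀ i → f i < N) →
          (∀ i → s₂ (f i * f i) ≡ s₂ (f i)) → C ≤ count N
count-≥ {C} N f f-injective 1≤f f<N solves = injective⇒≤ position-injective
  where
  member : ∀ i → f i ∈ filter solution? (positivesBelow N)
  member i = ∈-filter⁺ solution? (∈-positivesBelow (1≤f i) (f<N i)) (solves i)
  position : Fin C → Fin (count N)
  position i = index (member i)
  position-injective : Injective _≡_ _≡_ position
  position-injective {i} {k} same = f-injective (trans (lookup-index (member i))
    (trans (cong (lookup (filter solution? (positivesBelow N))) same) (sym (lookup-index (member k)))))

count-lower : ∀ k N → 2 ^ (16 * suc k) ≤ N → 2 ^ k ≤ count N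
count-lower k N 2^16c≤N =
  count-≥ N member member-injective F.1≤n (λ i → <-≤-trans (F.n<2^16c i) 2^16c≤N) F.solution
  where
  y<2^c : ∀ (i : Fin (2 ^ k)) → suc (toℕ i) < 2 ^ suc k
  y<2^c i = <-≤-trans (s≤s (toℕ<n i)) (^-monoʳ-< 2 (s≤s (s≤s z≤n)) (n<1+n k))
  module F (i : Fin (2 ^ k)) = Family (suc k) (s≤s z≤n) (suc (toℕ i)) (s≤s z≤n) (y<2^c i)
  member : Fin (2 ^ k) → ℕ
  member i = F.n i
  member-injective : Injective _≡_ _≡_ member
  member-injective {i} {i′} same =
    toℕ-injective (suc-injective (family-injective (suc k) (s≤s z≤n) (s≤s z≤n) (y<2^c i) (s≤s z≤n) (y<2^c i′) same))

power-bracket : ∀ {B} → 2 ≤ B → ∀ N → 1 ≤ N → ∃[ c ] B ^ c ≤ N × N < B ^ suc c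
power-bracket {B} 2≤B (suc zero) _ = 0 , ≤-refl , subst (1 <_) (sym (*-identityʳ B)) 2≤B
power-bracket {B} 2≤B (suc (suc N)) _ with power-bracket 2≤B (suc N) (s≤s z≤n)
... | c , lo , hi with m≤n⇒m<n∨m≡n hi
...   | inj₁ below = c , ≤-trans lo (n≤1+n (suc N)) , below
...   | inj₂ at-power = suc c , ≤-reflexive (sym at-power)
                   , subst (_< B ^ suc (suc c)) (sym at-power) (^-monoʳ-< B 2≤B (n<1+n (suc c)))

power-bracket-above : ∀ {B} → 2 ≤ B → ∀ N → B ≤ N → ∃[ k ] B ^ suc k ≤ N × N < B ^ suc (suc k)
power-bracket-above {B} 2≤B N B≤N with power-bracket 2≤B N (≤-trans (≤-trans (s≤s z≤n) 2≤B) B≤N)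
... | zero  , _  , hi = ⊥-elim (<⇒≱ hi (subst (_≤ N) (sym (*-identityʳ B)) B≤N))
... | suc k , lo , hi = k , lo , hi

growth-from-dyadic : ∀ a b (g : ℕ → ℕ) → 1 ≤ a → a ≤ b → (∀ k N → 2 ^ (a * suc k) ≤ N → 2 ^ k ≤ g N) →
                     ∀ N → 2 ^ a ≤ N → N ≤ 2 ^ (2 * a) * g N ^ b
growth-from-dyadic a b g 1≤a a≤b dyadic N 2^a≤N
  with power-bracket-above (^-monoʳ-≤ 2 1≤a) N 2^a≤N
... | k , lo , hi = <⇒≤ (begin-strict
  N                          <⟨ hi ⟩
  (2 ^ a) ^ suc (suc k)      ≡⟨ ^-*-assoc 2 a (suc (suc k)) ⟩
  2 ^ (a * suc (suc k))      ≡⟨ cong (2 ^_) (exponent a k) ⟩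
  2 ^ (2 * a + a * k)        ≡⟨ ^-distribˡ-+-* 2 (2 * a) (a * k) ⟩
  2 ^ (2 * a) * 2 ^ (a * k)  ≤⟨ *-monoʳ-≤ (2 ^ (2 * a)) (^-monoʳ-≤ 2 (*-monoˡ-≤ k a≤b)) ⟩
  2 ^ (2 * a) * 2 ^ (b * k)  ≡⟨ cong (λ e → 2 ^ (2 * a) * 2 ^ e) (*-comm b k) ⟩
  2 ^ (2 * a) * 2 ^ (k * b)  ≡⟨ cong (2 ^ (2 * a) *_) (sym (^-*-assoc 2 k b)) ⟩
  2 ^ (2 * a) * (2 ^ k) ^ b  ≤⟨ *-monoʳ-≤ (2 ^ (2 * a)) (^-monoˡ-≤ b (dyadic k N 2^a[k+1]≤N)) ⟩
  2 ^ (2 * a) * g N ^ b      ∎)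
  where
  open ≤-Reasoning
  exponent : ∀ a k → a * suc (suc k) ≡ 2 * a + a * k
  exponent = solve-∀
  2^a[k+1]≤N : 2 ^ (a * suc k) ≤ N
  2^a[k+1]≤N = subst (_≤ N) (^-*-assoc 2 a (suc k)) lo

theorem1p2 : ∃[ K ] ∃[ N₀ ] (∀ N → N ≥ N₀ → N ≤ K * count N ^ 19)
theorem1p2 = 2 ^ (2 * 16) , 2 ^ 16 , growth-from-dyadic 16 19 count (s≤s z≤n) (m≤m+n 16 3) count-lower
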